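{- Let $G=(V,E)$ be a finite directed graph with $n=|V|$, let $v\in V$, and let $\alpha(v),\omega(v)$ be integers with $1<\alpha(v)\le r(v)\le\omega(v)$. For an integer $x$ and $d\ge0$ let \[ \tilde f_d(v,x)=\sum_{w\in N_d(v)} d(v,w)\;-\;\sum_{u\in\Gamma_d(v)}\deg^{+}(u)\;+\;(d+2)\bigl(x-n_d(v)\bigr). \] Then for every integer $d\ge 0$, \[ \frac{1}{c(v)}\;\ge\;\lambda_d(v):=(n-1)\min\!\left(\frac{\tilde f_d(v,\alpha(v))}{(\alpha(v)-1)^2},\;\frac{\tilde f_d(v,\omega(v))}{(\omega(v)-1)^2}\right), \] where $c(v)=\dfrac{(r(v)-1)^2}{(n-1)\,f(v)}$ and $f(v)=\sum_{w\in R(v)} d(v,w)$.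
   Context: $d(v,w)$ is the number of arcs in a shortest directed path from $v$ to $w$. $R(v)$ is the set of vertices reachable from $v$ (with $v\in R(v)$), and $r(v)=|R(v)|$. $\Gamma_d(v)=\{w: d(v,w)=d\}$; $N_d(v)=\{w: d(v,w)\le d\}$ and $n_d(v)=|N_d(v)|$; $\deg^+(u)$ is the out-degree of $u$. $f(v)$ is the farness and $c(v)$ the closeness of $v$; $\alpha(v)$ and $\omega(v)$ are any lower and upper bounds on $r(v)$. -}

module Defs where

open import Data.Bool using (Bool; true; false; if_then_else_; _∧_; _∨_; not)
open import Data.Nat as ℕ using (ℕ; zero; suc; _∸_)
open import Data.Fin using (Fin; _≟_)
open import Data.List using (List; map; allFin)
open import Data.Nat.ListAction using (sum)
open import Data.Bool.ListAction using (any)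
open import Data.Integer as ℤ using (ℤ; +_; _-_)
open import Data.Rational as ℚ using (ℚ; 0ℚ; _/_)
open import Relation.Nullary.Decidable using (⌊_⌋)

-- A finite directed graph on the vertex set Fin n, given by its arc relation:
-- there is an arc u → w iff adj u w ≡ true.
Digraph : ℕ → Set
Digraph n = Fin n → Fin n → Bool

module _ {n : ℕ} (G : Digraph n) where

  Σv : (Fin n → ℕ) → ℕ
  Σv f = sum (map f (allFin n))

  outdeg : Fin n → ℕ
  outdeg u = Σv (λ w → if G u w then 1 else 0)

  -- ball v k w = true iff there is a directed walk (equivalently path) of
  -- length ≤ k from v to w, i.e. w ∈ N_k(v).
  ball : Fin n → ℕ → Fin n → Bool
  ball v zero    w = ⌊ v ≟ w ⌋
  ball v (suc k) w = ball v k w ∨ any (λ u → ball v k u ∧ G u w) (allFin n)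

  -- reachability: w ∈ R(v).  Any reachable vertex is reachable by a path
  -- with at most n - 1 arcs, so this is the set of all reachable vertices.
  reach : Fin n → Fin n → Bool
  reach v w = ball v (n ∸ 1) w

  -- least k < m with p k (m if there is none)
  firstTrue : (ℕ → Bool) → ℕ → ℕ
  firstTrue p zero    = zero
  firstTrue p (suc m) = if p zero then zero else suc (firstTrue (λ k → p (suc k)) m)

  -- d(v,w): number of arcs of a shortest directed path from v to w
  -- (meaningful only for w ∈ R(v); it is only ever used for such w).
  dist : Fin n → Fin n → ℕ
  dist v w = firstTrue (λ k → ball v k w) n

  r : Fin n → ℕ
  r v = Σv (λ w → if reach v w then 1 else 0)

  nball : Fin n → ℕ → ℕ
  nball v d = Σv (λ w → if ball v d w then 1 else 0)

  farness : Fin n → ℕ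
  farness v = Σv (λ w → if reach v w then dist v w else 0)

  sphere : Fin n → ℕ → Fin n → Bool
  sphere v d w = reach v w ∧ ⌊ dist v w ℕ.≟ d ⌋

  ftilde : Fin n → ℕ → ℤ → ℤ
  ftilde v d x =
    ((+ Σv (λ w → if ball v d w then dist v w else 0))
      - (+ Σv (λ u → if sphere v d u then outdeg u else 0)))
    ℤ.+ (+ (d ℕ.+ 2)) ℤ.* (x - + nball v d)

-- p // q = p / q as a rational; the value for q = 0 is a junk value (0)
-- and never arises under the hypotheses of the statement.
_//_ : ℤ → ℕ → ℚ
p // zero    = 0ℚ
p // (suc q) = p / suc q

module _ {n : ℕ} (G : Digraph n) where

  closeness : Fin n → ℚ
  closeness v = (+ ((r G v ∸ 1) ℕ.* (r G v ∸ 1))) // ((n ∸ 1) ℕ.* farness G v)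

  lambda : Fin n → ℕ → ℕ → ℕ → ℚ
  lambda v α ω d =
    ((+ (n ∸ 1)) // 1) ℚ.*
      ((ftilde G v d (+ α) // ((α ∸ 1) ℕ.* (α ∸ 1)))
        ℚ.⊓ (ftilde G v d (+ ω) // ((ω ∸ 1) ℕ.* (ω ∸ 1))))

-- total reciprocal: 1/q for q ≠ 0 (junk value 0 at q = 0, never used since c(v) > 0
-- under the hypotheses)
recip : ℚ → ℚ
recip (ℚ.mkℚ (+ zero) _ _)          = 0ℚ
recip q@(ℚ.mkℚ (+ suc _) _ _)       = ℚ.1/ q
recip q@(ℚ.mkℚ ℤ.-[1+ _ ] _ _)      = ℚ.1/ q

-- For a fixed depth d, f̃_d(v, x) is affine in x with slope d + 2 ≥ 0, and f̃_d(v, r(v)) ≤ f(v):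
-- a vertex outside N_d(v) lies at distance ≥ d + 2 unless it is at distance exactly d + 1, in
-- which case some arc from Γ_d(v) enters it, and the arcs out of Γ_d(v) are counted by the
-- out-degrees.  Writing t = x − 1, the ratio (C + B t)/t² with B ≥ 0 is quasi-concave for
-- t > 0, so on [α − 1, ω − 1] its minimum is attained at an endpoint.  Hence the minimum in
-- λ_d(v) is at most f̃_d(v, r(v))/(r(v) − 1)² ≤ f(v)/(r(v) − 1)², and multiplying by n − 1
-- gives (n − 1) f(v)/(r(v) − 1)² = 1/c(v).
module Submission where

open import Defs
open import Data.Bool using (Bool; true; false; if_then_else_; _∧_; _∨_)
open import Data.Bool.Properties using (T-≡; ∨-zeroʳ; ∧-conicalˡ; ∧-conicalʳ; not-¬; ¬-not)
open import Data.Bool.ListAction using (any)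
open import Data.Fin as Fin using (Fin; zero; suc; punchIn)
import Data.Fin.Properties as FinP
open import Data.Integer as ℤ using (ℤ; +_; 0ℤ; +≤+; +<+)
import Data.Integer.Properties as ℤP
open import Data.Integer.Tactic.RingSolver using (solve-∀)
open import Data.List using (tabulate; allFin)
open import Data.List.Membership.Propositional using (lose)
open import Data.List.Membership.Propositional.Properties using (∈-allFin)
open import Data.List.Properties using (map-tabulate)
open import Data.List.Relation.Unary.Any using (satisfied)
open import Data.List.Relation.Unary.Any.Properties using (any⁺; any⁻)
open import Data.Nat as ℕ using (ℕ; zero; suc; z≤n; s≤s)
open import Data.Nat.ListAction using (sum)
import Data.Nat.Properties as ℕP
open import Data.Product using (∃; _,_; _×_; proj₁; proj₂)
open import Data.Rational as ℚ using (ℚ; mkℚ; toℚᵘ; _≥_)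
import Data.Rational.Properties as ℚP
open import Data.Rational.Unnormalised using (mkℚᵘ; *≡*; *≤*) renaming (_≃_ to _≃ᵘ_)
import Data.Rational.Unnormalised.Properties as ℚᵘP
open import Data.Sum using (_⊎_; inj₁; inj₂; [_,_]′)
open import Data.Vec.Functional using (Vector)
open import Function using (_∘_; id)
open import Function.Bundles using (module Equivalence)
open import Relation.Binary.PropositionalEquality
open import Relation.Nullary using (contradiction; yes; no)
open import Relation.Nullary.Decidable using (⌊_⌋; isYes≗does; dec-true; dec-false)
open import Algebra.Properties.CommutativeMonoid.Sum ℕP.+-0-commutativeMonoid
  using (sum-cong-≗; ∑-distrib-+; ∑-comm; sum-remove; sum-replicate-zero) renaming (sum to ∑)
open import Algebra.Properties.Semiring.Sum ℕP.+-*-semiring using (*-distribˡ-sum)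

-- Integer arithmetic is opened only inside this block; elsewhere + and * are those of ℕ.
module _ where

  open import Data.Integer using (_+_; _*_; _-_; -_; _≤_; _<_)

  0≤*0≤ : ∀ {i j} → 0ℤ ≤ i → 0ℤ ≤ j → 0ℤ ≤ i * j
  0≤*0≤ {+ m} {+ n} _ _ = subst (0ℤ ≤_) (ℤP.pos-* m n) (+≤+ z≤n)

  0≤+0≤ : ∀ {i j} → 0ℤ ≤ i → 0ℤ ≤ j → 0ℤ ≤ i + j
  0≤+0≤ {+ m} {+ n} _ _ = +≤+ z≤n

  0≤-cancel-pos : ∀ {k i} → 0ℤ < k → 0ℤ ≤ k * i → 0ℤ ≤ i
  0≤-cancel-pos {k} {i} 0<k 0≤ki =
    ℤP.*-cancelˡ-≤-pos 0ℤ i k {{ℤ.positive 0<k}} (subst (_≤ k * i) (sym (ℤP.*-zeroʳ k)) 0≤ki)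

  private
    right-gap : ∀ C B s o → (C + B * s) * (o * o) - (C + B * o) * (s * s) ≡ (o - s) * (C * (o + s) + B * s * o)
    right-gap = solve-∀

    left-gap : ∀ C B a s → (C + B * s) * (a * a) - (C + B * a) * (s * s) ≡ (s - a) * - (C * (a + s) + B * s * a)
    left-gap = solve-∀

    chord : ∀ C B a s o → o * - (C * (a + s) + B * s * a) ≡ a * - (C * (o + s) + B * s * o) + (o - a) * (- C * s)
    chord = solve-∀

  -- With φ t = C (t + s) + B s t, each cross-multiplied comparison of (C + B t)/t² with its value
  -- at s factors through φ (right-gap, left-gap), and φ is affine in t with φ 0 = C s (chord):
  -- if φ o < 0 then C ≤ 0, hence φ a ≤ 0.
  module _ (C B : ℤ) {a s o : ℤ} (0≤B : 0ℤ ≤ B) (0<a : 0ℤ < a) (a≤s : a ≤ s) (s≤o : s ≤ o) where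

    private
      φ : ℤ → ℤ
      φ t = C * (t + s) + B * s * t

      0≤a : 0ℤ ≤ a
      0≤a = ℤP.<⇒≤ 0<a
      0≤s : 0ℤ ≤ s
      0≤s = ℤP.≤-trans 0≤a a≤s
      0≤o : 0ℤ ≤ o
      0≤o = ℤP.≤-trans 0≤s s≤o
      0<o : 0ℤ < o
      0<o = ℤP.<-≤-trans 0<a (ℤP.≤-trans a≤s s≤o)

      0≤-C : φ o < 0ℤ → 0ℤ ≤ - C
      0≤-C φo<0 with 0ℤ ℤP.≤? C
      ... | yes 0≤C = contradiction φo<0
                        (ℤP.≤⇒≯ (0≤+0≤ (0≤*0≤ 0≤C (0≤+0≤ 0≤o 0≤s))
                                       (0≤*0≤ (0≤*0≤ 0≤B 0≤s) 0≤o)))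
      ... | no  C≱0 = ℤP.<⇒≤ (ℤP.neg-mono-< (ℤP.≰⇒> C≱0))

    ratio-min-at-endpoint :
      (C + B * a) * (s * s) ≤ (C + B * s) * (a * a) ⊎ (C + B * o) * (s * s) ≤ (C + B * s) * (o * o)
    ratio-min-at-endpoint with 0ℤ ℤP.≤? φ o
    ... | yes 0≤φo = inj₂ (ℤP.0≤i-j⇒j≤i (subst (0ℤ ≤_) (sym (right-gap C B s o))
                       (0≤*0≤ (ℤP.i≤j⇒0≤j-i s≤o) 0≤φo)))
    ... | no  φo≱0 = inj₁ (ℤP.0≤i-j⇒j≤i (subst (0ℤ ≤_) (sym (left-gap C B a s))
                       (0≤*0≤ (ℤP.i≤j⇒0≤j-i a≤s) 0≤-φa)))
      where
        φo<0 : φ o < 0ℤ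
        φo<0 = ℤP.≰⇒> φo≱0
        0≤-φa : 0ℤ ≤ - φ a
        0≤-φa = 0≤-cancel-pos 0<o (subst (0ℤ ≤_) (sym (chord C B a s o))
          (0≤+0≤ (0≤*0≤ 0≤a (ℤP.<⇒≤ (ℤP.neg-mono-< φo<0)))
                 (0≤*0≤ (ℤP.i≤j⇒0≤j-i (ℤP.≤-trans a≤s s≤o)) (0≤*0≤ (0≤-C φo<0) 0≤s))))

  difference-form-≤ : ∀ {s t b x y f} → s ℕ.+ b ℕ.* x ℕ.≤ f ℕ.+ (t ℕ.+ b ℕ.* y) →
    (+ s - + t) + + b * (+ x - + y) ≤ + f
  difference-form-≤ {s} {t} {b} {x} {y} {f} h = begin
    (+ s - + t) + + b * (+ x - + y)       ≡⟨ regroup (+ s) (+ t) (+ b) (+ x) (+ y) ⟩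
    (+ s + + b * + x) - (+ t + + b * + y) ≡⟨ cong₂ _-_ (pos-+* s b x) (pos-+* t b y) ⟨
    + (s ℕ.+ b ℕ.* x) - + K               ≤⟨ ℤP.+-monoˡ-≤ (- + K) (+≤+ h) ⟩
    + (f ℕ.+ K) - + K                     ≡⟨ cong (_- + K) (ℤP.pos-+ f K) ⟩
    (+ f + + K) - + K                     ≡⟨ cancel (+ f) (+ K) ⟩
    + f                                   ∎
    where
      open ℤP.≤-Reasoning
      K = t ℕ.+ b ℕ.* y
      regroup : ∀ s t b x y → (s - t) + b * (x - y) ≡ (s + b * x) - (t + b * y)
      regroup = solve-∀
      cancel : ∀ i j → (i + j) - j ≡ i
      cancel = solve-∀
      pos-+* : ∀ p q r → + (p ℕ.+ q ℕ.* r) ≡ + p + + q * + r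
      pos-+* p q r = trans (ℤP.pos-+ p (q ℕ.* r)) (cong (λ z → + p + z) (ℤP.pos-* q r))

toℚᵘ-// : ∀ p m → toℚᵘ (p // suc m) ≃ᵘ mkℚᵘ p m
toℚᵘ-// p m = ℚP.toℚᵘ-fromℚᵘ (mkℚᵘ p m)

//-mono-≤ : ∀ {p q m k} → 0 ℕ.< m → 0 ℕ.< k → p ℤ.* + k ℤ.≤ q ℤ.* + m → p // m ℚ.≤ q // k
//-mono-≤ {p} {q} {suc m} {suc k} _ _ pk≤qm = ℚP.toℚᵘ-cancel-≤
  (ℚᵘP.≤-respˡ-≃ (ℚᵘP.≃-sym (toℚᵘ-// p m))
    (ℚᵘP.≤-respʳ-≃ (ℚᵘP.≃-sym (toℚᵘ-// q k)) (*≤* pk≤qm)))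

//-sq-≤ : ∀ {p q i e s} → 0 ℕ.< e → 0 ℕ.< s →
  p ℤ.* (+ s ℤ.* + s) ℤ.≤ q ℤ.* (+ e ℤ.* + e) → q ℤ.≤ i → p // (e ℕ.* e) ℚ.≤ i // (s ℕ.* s)
//-sq-≤ {p} {q} {i} {e@(suc _)} {s@(suc _)} _ _ ps²≤qe² q≤i =
  //-mono-≤ {p} {i} {e ℕ.* e} {s ℕ.* s} (s≤s z≤n) (s≤s z≤n) (begin
  p ℤ.* + (s ℕ.* s)      ≡⟨ cong (p ℤ.*_) (ℤP.pos-* s s) ⟩
  p ℤ.* (+ s ℤ.* + s)    ≤⟨ ps²≤qe² ⟩
  q ℤ.* (+ e ℤ.* + e)    ≡⟨ cong (q ℤ.*_) (ℤP.pos-* e e) ⟨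
  q ℤ.* + (e ℕ.* e)      ≤⟨ ℤP.*-monoʳ-≤-nonNeg (+ (e ℕ.* e)) q≤i ⟩
  i ℤ.* + (e ℕ.* e)      ∎)
  where open ℤP.≤-Reasoning

//-* : ∀ p q {m k} → 0 ℕ.< m → 0 ℕ.< k → (p // m) ℚ.* (q // k) ≡ (p ℤ.* q) // (m ℕ.* k)
//-* p q {suc m} {suc k} _ _ = ℚP.toℚᵘ-injective (ℚᵘP.≃-trans (ℚP.toℚᵘ-homo-* (p // suc m) (q // suc k))
  (ℚᵘP.≃-trans (ℚᵘP.*-cong (toℚᵘ-// p m) (toℚᵘ-// q k)) (ℚᵘP.≃-sym (toℚᵘ-// (p ℤ.* q) _))))

recip-// : ∀ {a b} → 0 ℕ.< a → 0 ℕ.< b → recip ((+ a) // b) ≡ (+ b) // a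
recip-// {suc a} {suc b} _ _ =
  ℚP.toℚᵘ-injective (ℚᵘP.≃-trans (toℚᵘ-recip (toℚᵘ-// (+ suc a) b))
                                 (ℚᵘP.≃-sym (toℚᵘ-// (+ suc b) a)))
  where
    toℚᵘ-recip : ∀ {q j k} → toℚᵘ q ≃ᵘ mkℚᵘ (+ suc j) k → toℚᵘ (recip q) ≃ᵘ mkℚᵘ (+ suc k) j
    toℚᵘ-recip {mkℚ (+ suc x) d _} {j} {k} (*≡* eq) =
      *≡* (trans (ℤP.*-comm (+ suc d) (+ suc j)) (trans (sym eq) (ℤP.*-comm (+ suc x) (+ suc k))))

open import Data.Nat using (_+_; _*_; _∸_; _≤_; _<_)

0<*0< : ∀ {m k} → 0 < m → 0 < k → 0 < m * k
0<*0< {suc _} {suc _} _ _ = s≤s z≤n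

1<⇒0<∸1 : ∀ {m} → 1 < m → 0 < m ∸ 1
1<⇒0<∸1 (s≤s (s≤s _)) = s≤s z≤n

<⇒≤∸1 : ∀ {k m} → k < m → k ≤ m ∸ 1
<⇒≤∸1 (s≤s k≤m) = k≤m

∸1< : ∀ {m} → Fin m → m ∸ 1 < m
∸1< {suc m} _ = ℕP.n<1+n m

any-allFin⁺ : ∀ {n} (p : Fin n → Bool) u → p u ≡ true → any p (allFin n) ≡ true
any-allFin⁺ p u pu = Equivalence.to T-≡ (any⁺ p (lose (∈-allFin u) (Equivalence.from T-≡ pu)))

any-allFin⁻ : ∀ {n} (p : Fin n → Bool) → any p (allFin n) ≡ true → ∃ λ u → p u ≡ true
any-allFin⁻ p h = let u , pu = satisfied (any⁻ p (allFin _) (Equivalence.from T-≡ h)) in u , Equivalence.to T-≡ pu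

∑-mono-≤ : ∀ {n} {f g : Vector ℕ n} → (∀ i → f i ≤ g i) → ∑ f ≤ ∑ g
∑-mono-≤ {zero}  f≤g = z≤n
∑-mono-≤ {suc n} f≤g = ℕP.+-mono-≤ (f≤g zero) (∑-mono-≤ (f≤g ∘ suc))

∑-const : ∀ n c → ∑ {n} (λ _ → c) ≡ n * c
∑-const zero    c = refl
∑-const (suc n) c = cong (_+_ c) (∑-const n c)

≤-∑ : ∀ {n} (f : Vector ℕ n) i → f i ≤ ∑ f
≤-∑ {suc n} f i = ℕP.≤-trans (ℕP.m≤m+n (f i) _) (ℕP.≤-reflexive (sym (sum-remove f)))

∑-indicator-≟ : ∀ {n} (v : Fin n) → ∑ (λ w → if ⌊ v Fin.≟ w ⌋ then 1 else 0) ≡ 1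
∑-indicator-≟ {suc n} v = begin
  ∑ t                         ≡⟨ sum-remove t ⟩
  t v + ∑ (t ∘ punchIn v)
    ≡⟨ cong₂ _+_ (cong indicator ≟-refl) (sum-cong-≗ (cong indicator ∘ ≟-punchIn)) ⟩
  1 + ∑ {n} (λ _ → 0)         ≡⟨ cong suc (sum-replicate-zero n) ⟩
  1                           ∎
  where
    open ≡-Reasoning
    indicator : Bool → ℕ
    indicator b = if b then 1 else 0
    t : Vector ℕ (suc n)
    t w = indicator ⌊ v Fin.≟ w ⌋
    ≟-refl : ⌊ v Fin.≟ v ⌋ ≡ true
    ≟-refl = trans (isYes≗does (v Fin.≟ v)) (dec-true (v Fin.≟ v) refl)
    ≟-punchIn : ∀ w → ⌊ v Fin.≟ punchIn v w ⌋ ≡ false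
    ≟-punchIn w = trans (isYes≗does (v Fin.≟ _)) (dec-false (v Fin.≟ _) (FinP.punchInᵢ≢i v w ∘ sym))

*-indicator : ∀ c b → c * (if b then 1 else 0) ≡ (if b then c else 0)
*-indicator c true  = ℕP.*-identityʳ c
*-indicator c false = ℕP.*-zeroʳ c

module _ {n : ℕ} (G : Digraph n) where

  Σv≡∑ : ∀ f → Σv G f ≡ ∑ f
  Σv≡∑ f = trans (cong sum (map-tabulate id f)) (sum-tabulate f)
    where
      sum-tabulate : ∀ {m} (f : Vector ℕ m) → sum (tabulate f) ≡ ∑ f
      sum-tabulate {zero}  f = refl
      sum-tabulate {suc m} f = cong (_+_ (f zero)) (sum-tabulate (f ∘ suc))

  firstTrue-≤ : ∀ p m → firstTrue G p m ≤ m
  firstTrue-≤ p zero    = z≤n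
  firstTrue-≤ p (suc m) with p zero
  ... | true  = z≤n
  ... | false = s≤s (firstTrue-≤ (p ∘ suc) m)

  firstTrue-minimal : ∀ p {m k} → p k ≡ true → k < m → firstTrue G p m ≤ k
  firstTrue-minimal p {suc m} {k} pk (s≤s k≤m) with p zero in p0
  ... | true  = z≤n
  firstTrue-minimal p {suc m} {zero}  pk _         | false = contradiction (trans (sym pk) p0) λ ()
  firstTrue-minimal p {suc m} {suc k} pk (s≤s k<m) | false = s≤s (firstTrue-minimal (p ∘ suc) pk k<m)

  firstTrue-true : ∀ p m → firstTrue G p m < m → p (firstTrue G p m) ≡ true
  firstTrue-true p (suc m) lt with p zero in p0
  ... | true  = p0
  firstTrue-true p (suc m) (s≤s lt) | false = firstTrue-true (p ∘ suc) m lt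

module _ {n : ℕ} (G : Digraph n) (v : Fin n) where

  ball-suc : ∀ {w} k → ball G v k w ≡ true → ball G v (suc k) w ≡ true
  ball-suc _ bw rewrite bw = refl

  ball-mono : ∀ {k l w} → k ≤ l → ball G v k w ≡ true → ball G v l w ≡ true
  ball-mono {l = zero}  z≤n bw = bw
  ball-mono {k} {suc l} k≤l bw with ℕP.m≤n⇒m<n∨m≡n k≤l
  ... | inj₁ (s≤s k≤l') = ball-suc l (ball-mono k≤l' bw)
  ... | inj₂ refl       = bw

  ball-arc : ∀ k {u w} → ball G v k u ≡ true → G u w ≡ true → ball G v (suc k) w ≡ true
  ball-arc k {u} {w} bu uw =
    trans (cong (ball G v k w ∨_) (any-allFin⁺ (λ u → ball G v k u ∧ G u w) u (cong₂ _∧_ bu uw))) (∨-zeroʳ _)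

  ball-suc⁻ : ∀ k {w} → ball G v (suc k) w ≡ true → ball G v k w ≡ false →
    ∃ λ u → ball G v k u ≡ true × G u w ≡ true
  ball-suc⁻ k {w} bw ¬bw =
    let u , bu∧uw = any-allFin⁻ arcFromBall (subst (λ b → b ∨ any arcFromBall (allFin n) ≡ true) ¬bw bw)
    in u , ∧-conicalˡ _ _ bu∧uw , ∧-conicalʳ _ _ bu∧uw
    where
      arcFromBall : Fin n → Bool
      arcFromBall u = ball G v k u ∧ G u w

  -- No bound on k is needed: for k ≥ n, dist w ≤ n ≤ k because firstTrue never exceeds n.
  dist-≤ : ∀ {k w} → ball G v k w ≡ true → dist G v w ≤ k
  dist-≤ {k} {w} bw with k ℕP.<? n
  ... | yes k<n = firstTrue-minimal G (λ j → ball G v j w) bw k<n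
  ... | no  k≮n = ℕP.≤-trans (firstTrue-≤ G _ n) (ℕP.≮⇒≥ k≮n)

  dist<n : ∀ {w} → reach G v w ≡ true → dist G v w < n
  dist<n rw = ℕP.≤-<-trans (dist-≤ rw) (∸1< v)

  ball-dist : ∀ {w} → dist G v w < n → ball G v (dist G v w) w ≡ true
  ball-dist {w} = firstTrue-true G (λ k → ball G v k w) n

  <-dist : ∀ {k w} → reach G v w ≡ true → ball G v k w ≡ false → k < dist G v w
  <-dist rw ¬bw = ℕP.≰⇒> λ dist≤k → not-¬ ¬bw (ball-mono dist≤k (ball-dist (dist<n rw)))

  sphere-true : ∀ {d u} → reach G v u ≡ true → dist G v u ≡ d → sphere G v d u ≡ true
  sphere-true {d} {u} ru du rewrite ru = trans (isYes≗does (dist G v u ℕ.≟ d)) (dec-true (dist G v u ℕ.≟ d) du)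

  sphere-predecessor : ∀ {d w} → reach G v w ≡ true → dist G v w ≡ suc d →
    ∃ λ u → sphere G v d u ≡ true × G u w ≡ true
  sphere-predecessor {d} {w} rw dw = u , sphere-true ru du , uw
    where
      bw : ball G v (suc d) w ≡ true
      bw = subst (λ k → ball G v k w ≡ true) dw (ball-dist (dist<n rw))
      ¬bw : ball G v d w ≡ false
      ¬bw = ¬-not λ b → ℕP.1+n≰n (subst (_≤ d) dw (dist-≤ b))
      d<n : d < n
      d<n = ℕP.<-trans (ℕP.n<1+n d) (subst (_< n) dw (dist<n rw))
      predecessor = ball-suc⁻ d bw ¬bw
      u : Fin n
      u = proj₁ predecessor
      bu : ball G v d u ≡ true
      bu = proj₁ (proj₂ predecessor)
      uw : G u w ≡ true
      uw = proj₂ (proj₂ predecessor)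
      ru : reach G v u ≡ true
      ru = ball-mono (<⇒≤∸1 d<n) bu
      du : dist G v u ≡ d
      du = ℕP.≤-antisym (dist-≤ bu) (ℕP.≮⇒≥ λ du<d →
             not-¬ ¬bw (ball-mono du<d (ball-arc (dist G v u) (ball-dist (ℕP.≤-<-trans (dist-≤ bu) d<n)) uw)))

  arcsFromSphere : ℕ → Fin n → ℕ
  arcsFromSphere d w = ∑ λ u → if sphere G v d u ∧ G u w then 1 else 0

  ∑-arcsFromSphere : ∀ d → Σv G (λ u → if sphere G v d u then outdeg G u else 0) ≡ ∑ (arcsFromSphere d)
  ∑-arcsFromSphere d = begin
    Σv G (λ u → if sphere G v d u then outdeg G u else 0) ≡⟨ Σv≡∑ G _ ⟩
    ∑ (λ u → if sphere G v d u then outdeg G u else 0)    ≡⟨ sum-cong-≗ outdeg-as-∑ ⟩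
    ∑ (λ u → ∑ (arc u))                                   ≡⟨ ∑-comm arc ⟩
    ∑ (arcsFromSphere d)                                  ∎
    where
      open ≡-Reasoning
      arc : Fin n → Fin n → ℕ
      arc u w = if sphere G v d u ∧ G u w then 1 else 0
      outdeg-as-∑ : ∀ u → (if sphere G v d u then outdeg G u else 0) ≡ ∑ (arc u)
      outdeg-as-∑ u with sphere G v d u
      ... | true  = Σv≡∑ G _
      ... | false = sym (sum-replicate-zero n)

  outside-ball : ∀ {d w} → reach G v w ≡ true → ball G v d w ≡ false → d + 2 ≤ dist G v w + arcsFromSphere d w
  outside-ball {d} {w} rw ¬bw with ℕP.m≤n⇒m<n∨m≡n (<-dist rw ¬bw)
  ... | inj₁ d+1<dist = ℕP.≤-trans (ℕP.≤-reflexive (ℕP.+-comm d 2)) (ℕP.≤-trans d+1<dist (ℕP.m≤m+n _ _))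
  ... | inj₂ d+1≡dist with sphere-predecessor rw (sym d+1≡dist)
  ...   | u , su , uw =
    ℕP.≤-trans (ℕP.≤-reflexive (ℕP.+-suc d 1)) (ℕP.+-mono-≤ (ℕP.≤-reflexive d+1≡dist) 1≤arcs)
    where
      1≤arcs : 1 ≤ arcsFromSphere d w
      1≤arcs = ℕP.≤-trans (ℕP.≤-reflexive (cong₂ (λ a b → if a ∧ b then 1 else 0) (sym su) (sym uw)))
                          (≤-∑ (λ u → if sphere G v d u ∧ G u w then 1 else 0) u)

  ftilde-numerator-≤-pointwise : ∀ d w →
      (if ball G v d w then dist G v w else 0) + (if reach G v w then d + 2 else 0)
    ≤ (if reach G v w then dist G v w else 0) + ((if ball G v d w then d + 2 else 0) + arcsFromSphere d w)
  ftilde-numerator-≤-pointwise d w with reach G v w in rw | ball G v d w in bw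
  ... | true  | true  = ℕP.+-monoʳ-≤ (dist G v w) (ℕP.m≤m+n (d + 2) _)
  ... | true  | false = outside-ball rw bw
  ... | false | true  = ℕP.≤-trans (ℕP.≤-reflexive (ℕP.+-identityʳ _))
                          (ℕP.≤-trans (dist-≤ bw) (ℕP.≤-trans (ℕP.m≤m+n d 2) (ℕP.m≤m+n _ _)))
  ... | false | false = z≤n

  *-Σv-indicator : ∀ c (b : Fin n → Bool) →
    c * Σv G (λ w → if b w then 1 else 0) ≡ ∑ (λ w → if b w then c else 0)
  *-Σv-indicator c b = trans (cong (c *_) (Σv≡∑ G _))
    (trans (*-distribˡ-sum c (λ w → if b w then 1 else 0)) (sum-cong-≗ (λ w → *-indicator c (b w))))

  -- f̃_d(v, r(v)) ≤ f(v), with the subtracted terms moved across so that it is an inequality in ℕ.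
  ftilde-numerator-≤ : ∀ d →
      Σv G (λ w → if ball G v d w then dist G v w else 0) + (d + 2) * r G v
    ≤ farness G v + (Σv G (λ u → if sphere G v d u then outdeg G u else 0) + (d + 2) * nball G v d)
  ftilde-numerator-≤ d = begin
    Σv G inBall + (d + 2) * r G v
      ≡⟨ cong₂ _+_ (Σv≡∑ G inBall) (*-Σv-indicator (d + 2) (reach G v)) ⟩
    ∑ inBall + ∑ weightR                            ≡⟨ sym (∑-distrib-+ inBall weightR) ⟩
    ∑ (λ w → inBall w + weightR w)                  ≤⟨ ∑-mono-≤ (ftilde-numerator-≤-pointwise d) ⟩
    ∑ (λ w → inR w + (weightBall w + arcsFromSphere d w))
      ≡⟨ trans (∑-distrib-+ inR _) (cong (_+_ (∑ inR)) (∑-distrib-+ weightBall (arcsFromSphere d))) ⟩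
    ∑ inR + (∑ weightBall + ∑ (arcsFromSphere d))   ≡⟨ cong (_+_ (∑ inR)) (ℕP.+-comm (∑ weightBall) _) ⟩
    ∑ inR + (∑ (arcsFromSphere d) + ∑ weightBall)
      ≡⟨ cong₂ _+_ (Σv≡∑ G inR) (cong₂ _+_ (∑-arcsFromSphere d) (*-Σv-indicator (d + 2) (ball G v d))) ⟨
    farness G v + (Σv G (λ u → if sphere G v d u then outdeg G u else 0) + (d + 2) * nball G v d) ∎
    where
      open ℕP.≤-Reasoning
      inBall inR weightR weightBall : Fin n → ℕ
      inBall w = if ball G v d w then dist G v w else 0
      inR w = if reach G v w then dist G v w else 0
      weightR w = if reach G v w then d + 2 else 0
      weightBall w = if ball G v d w then d + 2 else 0

  r≤n : r G v ≤ n
  r≤n = begin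
    r G v                                   ≡⟨ Σv≡∑ G _ ⟩
    ∑ (λ w → if reach G v w then 1 else 0)  ≤⟨ ∑-mono-≤ (λ w → indicator≤1 (reach G v w)) ⟩
    ∑ {n} (λ _ → 1)                         ≡⟨ trans (∑-const n 1) (ℕP.*-identityʳ n) ⟩
    n                                       ∎
    where
      open ℕP.≤-Reasoning
      indicator≤1 : ∀ b → (if b then 1 else 0) ≤ 1
      indicator≤1 true  = ℕP.≤-refl
      indicator≤1 false = z≤n

  r≤farness+1 : r G v ≤ farness G v + 1
  r≤farness+1 = begin
    r G v                                                        ≡⟨ Σv≡∑ G _ ⟩
    ∑ (λ w → if reach G v w then 1 else 0)                       ≤⟨ ∑-mono-≤ reached-at-positive-distance ⟩
    ∑ (λ w → inR w + (if ⌊ v Fin.≟ w ⌋ then 1 else 0))           ≡⟨ ∑-distrib-+ inR _ ⟩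
    ∑ inR + ∑ (λ w → if ⌊ v Fin.≟ w ⌋ then 1 else 0)
      ≡⟨ cong₂ _+_ (sym (Σv≡∑ G inR)) (∑-indicator-≟ v) ⟩
    farness G v + 1                                              ∎
    where
      open ℕP.≤-Reasoning
      inR : Fin n → ℕ
      inR w = if reach G v w then dist G v w else 0
      reached-at-positive-distance : ∀ w → (if reach G v w then 1 else 0) ≤ inR w + (if ⌊ v Fin.≟ w ⌋ then 1 else 0)
      reached-at-positive-distance w with reach G v w in rw
      ... | false = z≤n
      ... | true with dist G v w in dw
      ...   | suc _ = s≤s z≤n
      ...   | zero  = ℕP.≤-reflexive (cong (λ b → if b then 1 else 0)
                        (sym (subst (λ k → ball G v k w ≡ true) dw (ball-dist (dist<n rw)))))

  ftilde-r≤farness : ∀ d → ftilde G v d (+ r G v) ℤ.≤ + farness G v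
  ftilde-r≤farness d =
    difference-form-≤ {t = Σv G (λ u → if sphere G v d u then outdeg G u else 0)} {d + 2} {r G v} {nball G v d}
      (ftilde-numerator-≤ d)

  ftilde-affine : ∀ d {x} → 0 < x → ftilde G v d (+ x) ≡ ftilde G v d (+ 1) ℤ.+ + (d + 2) ℤ.* + (x ∸ 1)
  ftilde-affine d {suc t} _ = shift (+ S ℤ.- + T) (+ (d + 2)) (+ t) (+ nball G v d)
    where
      S T : ℕ
      S = Σv G (λ w → if ball G v d w then dist G v w else 0)
      T = Σv G (λ u → if sphere G v d u then outdeg G u else 0)
      shift : ∀ P B y m → P ℤ.+ B ℤ.* ((+ 1 ℤ.+ y) ℤ.- m) ≡ (P ℤ.+ B ℤ.* (+ 1 ℤ.- m)) ℤ.+ B ℤ.* y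
      shift = solve-∀

  min-ratio-≤ : ∀ d {α ω} → 1 < α → α ≤ r G v → r G v ≤ ω →
      (ftilde G v d (+ α) // ((α ∸ 1) * (α ∸ 1))) ℚ.⊓ (ftilde G v d (+ ω) // ((ω ∸ 1) * (ω ∸ 1)))
    ℚ.≤ (+ farness G v) // ((r G v ∸ 1) * (r G v ∸ 1))
  min-ratio-≤ d {α} {ω} 1<α α≤r r≤ω =
    [ (λ h → ℚP.p≤q⇒p⊓r≤q (ratio ω) (endpoint-≤ 1<α h))
    , (λ h → ℚP.p≤q⇒r⊓p≤q (ratio α) (endpoint-≤ 1<ω h)) ]′
      (ratio-min-at-endpoint C B (+≤+ z≤n) (+<+ (1<⇒0<∸1 1<α))
        (+≤+ (ℕP.∸-monoˡ-≤ 1 α≤r)) (+≤+ (ℕP.∸-monoˡ-≤ 1 r≤ω)))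
    where
      C B : ℤ
      C = ftilde G v d (+ 1)
      B = + (d + 2)
      s : ℕ
      s = r G v ∸ 1
      ratio : ℕ → ℚ
      ratio x = ftilde G v d (+ x) // ((x ∸ 1) * (x ∸ 1))
      1<r : 1 < r G v
      1<r = ℕP.<-≤-trans 1<α α≤r
      1<ω : 1 < ω
      1<ω = ℕP.<-≤-trans 1<r r≤ω
      endpoint-≤ : ∀ {x} → 1 < x →
          (C ℤ.+ B ℤ.* + (x ∸ 1)) ℤ.* (+ s ℤ.* + s) ℤ.≤ (C ℤ.+ B ℤ.* + s) ℤ.* (+ (x ∸ 1) ℤ.* + (x ∸ 1)) →
        ratio x ℚ.≤ (+ farness G v) // (s * s)
      endpoint-≤ {x} 1<x h = //-sq-≤ (1<⇒0<∸1 1<x) (1<⇒0<∸1 1<r)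
        (subst (λ p → p ℤ.* (+ s ℤ.* + s) ℤ.≤ (C ℤ.+ B ℤ.* + s) ℤ.* (+ (x ∸ 1) ℤ.* + (x ∸ 1)))
               (sym (ftilde-affine d (ℕP.<-trans (s≤s z≤n) 1<x))) h)
        (subst (ℤ._≤ + farness G v) (ftilde-affine d (ℕP.<-trans (s≤s z≤n) 1<r)) (ftilde-r≤farness d))

lemma2 : (n : ℕ) (G : Digraph n) (v : Fin n) (α ω : ℕ)
    → 1 < α → α ≤ r G v → r G v ≤ ω
    → (d : ℕ) → recip (closeness G v) ≥ lambda G v α ω d
lemma2 n G v α ω 1<α α≤r r≤ω d = begin
  lambda G v α ω d
    ≤⟨ ℚP.*-monoˡ-≤-nonNeg ((+ (n ∸ 1)) // 1) {{ℚP.normalize-nonNeg (n ∸ 1) 1}}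
         (min-ratio-≤ G v d 1<α α≤r r≤ω) ⟩
  ((+ (n ∸ 1)) // 1) ℚ.* ((+ f) // (s * s))   ≡⟨ //-* (+ (n ∸ 1)) (+ f) (s≤s z≤n) 0<s² ⟩
  ((+ (n ∸ 1)) ℤ.* (+ f)) // (1 * (s * s))
    ≡⟨ cong₂ _//_ (sym (ℤP.pos-* (n ∸ 1) f)) (ℕP.*-identityˡ (s * s)) ⟩
  (+ ((n ∸ 1) * f)) // (s * s)                 ≡⟨ recip-// 0<s² 0<[n∸1]f ⟨
  recip (closeness G v)                        ∎
  where
    open ℚP.≤-Reasoning
    f s : ℕ
    f = farness G v
    s = r G v ∸ 1
    1<r : 1 < r G v
    1<r = ℕP.<-≤-trans 1<α α≤r
    0<s² : 0 < s * s
    0<s² = 0<*0< (1<⇒0<∸1 1<r) (1<⇒0<∸1 1<r)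
    0<[n∸1]f : 0 < (n ∸ 1) * f
    0<[n∸1]f = 0<*0< (1<⇒0<∸1 (ℕP.<-≤-trans 1<r (r≤n G v)))
                     (ℕP.+-cancelʳ-< 1 0 f (ℕP.<-≤-trans 1<r (r≤farness+1 G v)))
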